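{- Let $G$ be a connected graph and let $\mathrm{Forb\text{ - }con}(G)$ be the class of graphs $M$ such that no connected component of $M$ is isomorphic to $G$. For $M,N\in\mathrm{Forb\text{ - }con}(G)$ define $M\preceq N$ iff $M$ is an induced subgraph of $N$ and for every complete subgraph $C$ of $N$ that is embeddable in $G$, if $C\cap M\neq\emptyset$ then $C\cap N\subseteq M$. Then smoothness holds: if $\delta$ is a limit ordinal, $\langle M_\alpha:\alpha<\delta\rangle$ is a $\preceq$-increasing continuous sequence in $\mathrm{Forb\text{ - }con}(G)$ with union $M_\delta\in\mathrm{Forb\text{ - }con}(G)$, $N\in\mathrm{Forb\text{ - }con}(G)$, and $M_\alpha\preceq N$ for every $\alpha<\delta$, then $M_\delta\preceq N$.
   Context: A graph is a structure $(V,E)$ with $E$ an irreflexive symmetric binary relation; "embeddable in $G$" means isomorphic to an induced subgraph of $G$. A sequence is continuous if $M_\beta=\bigcup_{\alpha<\beta}M_\alpha$ for limit $\beta<\delta$. -}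

module Defs where

open import Level using (0ℓ)
open import Data.Product using (Σ; ∃; ∃-syntax; _×_; _,_)
open import Data.Empty using (⊥)
open import Relation.Nullary using (¬_)
open import Relation.Binary.PropositionalEquality using (_≡_)
open import Relation.Binary.Structures using (IsStrictTotalOrder)
open import Induction.WellFounded using (WellFounded)

-- A graph whose vertices form a subset V of an ambient type U; E is an
-- irreflexive symmetric relation (only its restriction to V matters).
record Graph (U : Set) : Set₁ where
  field
    V      : U → Set
    E      : U → U → Set
    irrefl : ∀ x → ¬ E x x
    sym    : ∀ {x y} → E x y → E y x
open Graph public

data Path {U : Set} (M : Graph U) : U → U → Set where
  here : ∀ {x} → V M x → Path M x x
  step : ∀ {x y z} → V M x → V M y → E M x y → Path M y z → Path M x z

Connected : {W : Set} → Graph W → Set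
Connected G = (∃[ w ] V G w) × (∀ x y → V G x → V G y → Path G x y)

induced : {U : Set} → Graph U → (U → Set) → Graph U
induced M S = record { V = λ x → S x × V M x ; E = E M ; irrefl = irrefl M ; sym = sym M }

record Iso {U W : Set} (A : Graph U) (B : Graph W) : Set where
  field
    to      : U → W
    from    : W → U
    to-V    : ∀ x → V A x → V B (to x)
    from-V  : ∀ w → V B w → V A (from w)
    from-to : ∀ x → V A x → from (to x) ≡ x
    to-from : ∀ w → V B w → to (from w) ≡ w
    pres    : ∀ x y → V A x → V A y → E A x y → E B (to x) (to y)
    refl-E  : ∀ x y → V A x → V A y → E B (to x) (to y) → E A x y

record Embedding {U W : Set} (A : Graph U) (B : Graph W) : Set where
  field
    f     : U → W
    f-V   : ∀ x → V A x → V B (f x)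
    inj   : ∀ x y → V A x → V A y → f x ≡ f y → x ≡ y
    pres  : ∀ x y → V A x → V A y → E A x y → E B (f x) (f y)
    refl-E : ∀ x y → V A x → V A y → E B (f x) (f y) → E A x y

EmbeddableIn : {U W : Set} → Graph U → Graph W → Set
EmbeddableIn A B = Embedding A B

component : {U : Set} → Graph U → U → Graph U
component M v = induced M (Path M v)

ForbCon : {U W : Set} → Graph W → Graph U → Set
ForbCon G M = ∀ v → V M v → ¬ Iso (component M v) G

_⊑_ : {U : Set} → Graph U → Graph U → Set
M ⊑ N = (∀ x → V M x → V N x)
      × (∀ x y → V M x → V M y → (E M x y → E N x y) × (E N x y → E M x y))

Complete : {U : Set} → Graph U → (U → Set) → Set
Complete N C = (∀ x → C x → V N x) × (∀ x y → C x → C y → ¬ x ≡ y → E N x y)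

Strong : {U W : Set} → Graph W → Graph U → Graph U → Set₁
Strong G M N =
  M ⊑ N ×
  ((C : _ → Set) → Complete N C → EmbeddableIn (induced N C) G →
     (∃[ x ] (C x × V M x)) → ∀ x → C x → V N x → V M x)

⋃ : {U I : Set} → (I → Set) → (I → Graph U) → Graph U
⋃ {U} {I} P M = record
  { V = λ x → ∃[ α ] (P α × V (M α) x)
  ; E = λ x y → ∃[ α ] (P α × V (M α) x × V (M α) y × E (M α) x y)
  ; irrefl = λ { x (α , _ , _ , _ , e) → irrefl (M α) x e }
  ; sym = λ { (α , p , vx , vy , e) → α , p , vy , vx , sym (M α) e } }

_≅ᵍ_ : {U : Set} → Graph U → Graph U → Set
A ≅ᵍ B = (∀ x → (V A x → V B x) × (V B x → V A x))
       × (∀ x y → V A x → V A y → (E A x y → E B x y) × (E B x y → E A x y))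

-- a limit ordinal δ, presented as the well-ordered set I of ordinals α < δ:
-- a well-founded strict total order, nonempty, with no largest element
record LimitOrdinal (I : Set) (_<_ : I → I → Set) : Set where
  field
    isSTO  : IsStrictTotalOrder _≡_ _<_
    wf     : WellFounded _<_
    nonempty : I
    noMax  : ∀ α → ∃[ β ] (α < β)

IsLimit : {I : Set} → (I → I → Set) → I → Set
IsLimit _<_ β = (∃[ α ] (α < β)) × (∀ α → α < β → ∃[ γ ] (α < γ × γ < β))

-- Both conditions defining M ≼ N pass to unions: the vertices of the union
-- lie in some M α ⊆ N, two of them lie in a common M γ because the chain is
-- totally ordered, so N and the union agree on their edges; and a clique of
-- N meeting the union meets some M α ≼ N, so it lies inside M α.
module Submission where

open import Defs
open import Data.Unit using (⊤; tt)
open import Data.Product using (∃-syntax; _×_; _,_; proj₁; proj₂)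
open import Relation.Binary.Structures using (IsStrictTotalOrder)
open import Relation.Binary.Definitions using (tri<; tri≈; tri>)
open import Relation.Binary.PropositionalEquality using (_≡_; refl)

_⊆ᵛ_ : {U : Set} → Graph U → Graph U → Set
A ⊆ᵛ B = ∀ x → V A x → V B x

Directed : {U I : Set} → (I → Set) → (I → Graph U) → Set
Directed P M = ∀ {α β} → P α → P β → ∃[ γ ] (P γ × M α ⊆ᵛ M γ × M β ⊆ᵛ M γ)

CliqueClosed : {U W : Set} → Graph W → Graph U → Graph U → Set₁
CliqueClosed G M N =
  (C : _ → Set) → Complete N C → EmbeddableIn (induced N C) G →
    (∃[ x ] (C x × V M x)) → ∀ x → C x → V N x → V M x

chain-directed : {U I : Set} {_<_ : I → I → Set} {M : I → Graph U} →
  IsStrictTotalOrder _≡_ _<_ → (∀ α β → α < β → M α ⊆ᵛ M β) →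
  Directed (λ _ → ⊤) M
chain-directed sto mono {α} {β} _ _ with IsStrictTotalOrder.compare sto α β
... | tri< α<β _ _ = β , tt , mono α β α<β , λ _ v → v
... | tri≈ _ refl _ = β , tt , (λ _ v → v) , λ _ v → v
... | tri> _ _ β<α = α , tt , (λ _ v → v) , mono β α β<α

⋃-⊑ : {U I : Set} {P : I → Set} {M : I → Graph U} {N : Graph U} →
  Directed P M → (∀ α → P α → M α ⊑ N) → ⋃ P M ⊑ N
⋃-⊑ {P = P} {M} {N} directed M⊑N = vertices , edges
  where
  vertices : ⋃ P M ⊆ᵛ N
  vertices x (α , pα , x∈α) = proj₁ (M⊑N α pα) x x∈α

  edges : ∀ x y → V (⋃ P M) x → V (⋃ P M) y →
          (E (⋃ P M) x y → E N x y) × (E N x y → E (⋃ P M) x y)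
  edges x y (α , pα , x∈α) (β , pβ , y∈β) = to , from
    where
    to : E (⋃ P M) x y → E N x y
    to (γ , pγ , x∈γ , y∈γ , xy) = proj₁ (proj₂ (M⊑N γ pγ) x y x∈γ y∈γ) xy

    from : E N x y → E (⋃ P M) x y
    from xy with directed pα pβ
    ... | γ , pγ , α⊆γ , β⊆γ =
      γ , pγ , x∈γ , y∈γ , proj₂ (proj₂ (M⊑N γ pγ) x y x∈γ y∈γ) xy
      where
      x∈γ = α⊆γ x x∈α
      y∈γ = β⊆γ y y∈β

⋃-cliqueClosed : {U W I : Set} {G : Graph W} {P : I → Set} {M : I → Graph U}
  {N : Graph U} → (∀ α → P α → CliqueClosed G (M α) N) →
  CliqueClosed G (⋃ P M) N
⋃-cliqueClosed closed C clique emb (x , x∈C , (α , pα , x∈α)) z z∈C z∈N =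
  α , pα , closed α pα C clique emb (x , x∈C , x∈α) z z∈C z∈N

⋃-strong : {U W I : Set} {G : Graph W} {P : I → Set} {M : I → Graph U}
  {N : Graph U} → Directed P M → (∀ α → P α → Strong G (M α) N) →
  Strong G (⋃ P M) N
⋃-strong {G = G} {P} {M} {N} directed strong =
  ⋃-⊑ {P = P} {M} {N} directed (λ α pα → proj₁ (strong α pα)) ,
  ⋃-cliqueClosed {G = G} {P} {M} (λ α pα → proj₂ (strong α pα))

mainTheorem10 : {U W : Set} (G : Graph W) → Connected G →
    (I : Set) (_<_ : I → I → Set) → LimitOrdinal I _<_ →
    (M : I → Graph U) →
    (∀ α → ForbCon G (M α)) →
    (∀ α β → α < β → Strong G (M α) (M β)) →
    (∀ β → IsLimit _<_ β → M β ≅ᵍ ⋃ (λ α → α < β) M) →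
    ForbCon G (⋃ (λ _ → ⊤) M) →
    (N : Graph U) → ForbCon G N →
    (∀ α → Strong G (M α) N) →
    Strong G (⋃ (λ _ → ⊤) M) N
mainTheorem10 G _ _ _<_ δ M _ increasing _ _ _ _ M≼N =
  ⋃-strong {G = G} {M = M}
    (chain-directed {_<_ = _<_} {M} (LimitOrdinal.isSTO δ) M⊆ᵛM)
    (λ α _ → M≼N α)
  where
  M⊆ᵛM : ∀ α β → α < β → M α ⊆ᵛ M β
  M⊆ᵛM α β α<β = proj₁ (proj₁ (increasing α β α<β))
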